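{- Let $n\geq 3$ be an integer. Among all trees on $n$ vertices, the maximum tenacity is $1$ if $n$ is odd and $\frac{n+2}{n}$ if $n$ is even.
   Context: All graphs are finite and simple. For a graph $G$, $\omega(G)$ denotes the number of components of $G$ and $\tau(G)$ the order of a largest component of $G$. The tenacity of a noncomplete connected graph $G$ is $T(G)=\min\left\{\frac{|X|+\tau(G-X)}{\omega(G-X)} : X\subset V(G),\ \omega(G-X)>1\right\}$. -}

module Defs where

open import Data.Bool using (Bool; true; false; _∧_; _∨_; not; if_then_else_)
open import Data.Nat using (ℕ; zero; suc; _+_; _⊔_; _<ᵇ_; _<_; _%_; _≡ᵇ_)
open import Data.Fin using (Fin; toℕ; _≟_)
open import Data.List using (List; []; _∷_; length; map; foldr; allFin; last)
open import Data.Nat.ListAction using (sum)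
open import Data.Bool.ListAction using (any; all)
open import Data.List.Relation.Unary.Unique.Propositional using (Unique)
open import Data.Maybe using (Maybe; just; nothing)
open import Data.Integer using (+_)
open import Data.Rational using (ℚ; _/_; 0ℚ; 1ℚ) renaming (_≤_ to _≤ℚ_)
open import Data.Product using (Σ; _×_; ∃)
open import Data.Unit using (⊤)
open import Data.Empty using (⊥)
open import Relation.Nullary using (¬_)
open import Relation.Nullary.Decidable using (⌊_⌋)
open import Relation.Binary.PropositionalEquality using (_≡_)

record Graph (n : ℕ) : Set where
  field
    adj   : Fin n → Fin n → Bool
    sym   : ∀ u v → adj u v ≡ adj v u
    irrefl : ∀ u → adj u u ≡ false
open Graph public

VSet : ℕ → Set
VSet n = Fin n → Bool

emptySet : ∀ {n} → VSet n
emptySet _ = false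

count : ∀ {n} → (Fin n → Bool) → ℕ
count {n} p = sum (map (λ i → if p i then 1 else 0) (allFin n))

alive : ∀ {n} → VSet n → Fin n → Bool
alive X v = not (X v)

reachW : ∀ {n} → Graph n → VSet n → ℕ → Fin n → Fin n → Bool
reachW G X zero    u v = alive X u ∧ ⌊ u ≟ v ⌋
reachW {n} G X (suc k) u v =
  reachW G X k u v ∨ any (λ w → reachW G X k u w ∧ adj G w v ∧ alive X v) (allFin n)

-- u and v lie in the same component of G - X
-- (a walk in a graph on n vertices can be shortened to a path with < n edges)
conn : ∀ {n} → Graph n → VSet n → Fin n → Fin n → Bool
conn {n} G X u v = reachW G X n u v

isRep : ∀ {n} → Graph n → VSet n → Fin n → Bool
isRep {n} G X v = alive X v ∧ all (λ u → not ((toℕ u <ᵇ toℕ v) ∧ conn G X u v)) (allFin n)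

ω : ∀ {n} → Graph n → VSet n → ℕ
ω G X = count (isRep G X)

τ : ∀ {n} → Graph n → VSet n → ℕ
τ {n} G X = foldr _⊔_ 0 (map (λ v → count (conn G X v)) (allFin n))

-- a / b as a rational (b = 0 never occurs where used; default 0)
ratio : ℕ → ℕ → ℚ
ratio a zero    = 0ℚ
ratio a (suc b) = (+ a) / suc b

tenRatio : ∀ {n} → Graph n → VSet n → ℚ
tenRatio G X = ratio (count X + τ G X) (ω G X)

IsTenacity : ∀ {n} → Graph n → ℚ → Set
IsTenacity G t =
  (Σ (VSet _) λ X → (1 < ω G X) × (tenRatio G X ≡ t)) ×
  (∀ (X : VSet _) → 1 < ω G X → t ≤ℚ tenRatio G X)

Connected : ∀ {n} → Graph n → Set
Connected {n} G = ∀ (u v : Fin n) → conn G emptySet u v ≡ true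

IsWalk : ∀ {n} → Graph n → List (Fin n) → Set
IsWalk G []            = ⊤
IsWalk G (x ∷ [])      = ⊤
IsWalk G (x ∷ y ∷ xs)  = (adj G x y ≡ true) × IsWalk G (y ∷ xs)

Closes : ∀ {n} → Graph n → List (Fin n) → Set
Closes G []       = ⊥
Closes G (x ∷ xs) with last (x ∷ xs)
... | just y  = adj G y x ≡ true
... | nothing = ⊥

IsCycle : ∀ {n} → Graph n → List (Fin n) → Set
IsCycle G vs = (3 Data.Nat.≤ length vs) × Unique vs × IsWalk G vs × Closes G vs

Acyclic : ∀ {n} → Graph n → Set
Acyclic {n} G = ∀ (vs : List (Fin n)) → ¬ IsCycle G vs

IsTree : ∀ {n} → Graph n → Set
IsTree G = Connected G × Acyclic G

maxTreeTenacity : ℕ → ℚ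
maxTreeTenacity n = if n % 2 ≡ᵇ 1 then 1ℚ else ratio (n + 2) n

-- A tree is bipartite: colour each vertex by the parity of a walk to it from a fixed root; an edge
-- joining two vertices of the same colour would close an odd walk, and an odd closed walk contains a
-- cycle. Deleting the smaller colour class X, with |X| = a ≤ b = n − a, leaves b isolated vertices,
-- so the tenacity is at most (a + 1)/b. This is at most 1 when n is odd (then a < b) and at most
-- (n + 2)/n when n is even. The path Pₙ attains the bound: every deleted vertex starts at most one
-- new component, so ω(Pₙ − X) ≤ |X| + 1; moreover ω ≤ n − |X| and τ ≥ 1, and τ = 1 forces every
-- surviving vertex to be isolated. Together these give (|X| + τ)/ω ≥ 1 for odd n and ≥ (n + 2)/n
-- for even n.

module Submission where

open import Defs renaming (sym to adj-sym)
open import Data.Bool using (Bool; true; false; _∧_; _∨_; not; if_then_else_; T)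
open import Data.Bool.ListAction using (any; all; and; or)
open import Data.Bool.Properties using (not-involutive; not-injective; not-¬; ∨-comm)
open import Data.Nat using (_<?_; _≤?_; ℕ; zero; suc; _+_; _*_; _∸_; _≤_; _<_; _⊔_; _<ᵇ_; _≡ᵇ_; _%_; z≤n; s≤s; s≤s⁻¹; z<s)
open import Data.Nat.Properties
open import Data.Nat.ListAction using (sum)
open import Data.Nat.DivMod using ([m+n]%n≡m%n)
open import Data.Nat.Tactic.RingSolver using (solve-∀; solve)
open import Algebra.Properties.CommutativeMonoid.Sum +-0-commutativeMonoid
  using (sum-cong-≗; ∑-distrib-+; sum-remove; sum-replicate-zero) renaming (sum to ∑)
open import Data.Fin using (Fin; zero; suc; toℕ; inject₁; fromℕ<; punchIn; punchOut) renaming (_≟_ to _≟ᶠ_)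
open import Data.Fin.Properties using (punchInᵢ≢i; punchIn-punchOut; toℕ-injective; toℕ-fromℕ<; toℕ<n; toℕ-inject₁)
open import Data.List using (List; []; _∷_; length; map; foldr; allFin; tabulate; _++_; last)
open import Data.List.Properties using (map-tabulate; map-cong; ++-assoc; ++-identityʳ; length-++)
open import Data.List.Membership.Propositional using (_∈_)
open import Data.List.Membership.Propositional.Properties using (∈-++⁺ˡ; ∈-++⁺ʳ; ∈-map⁺; ∈-∃++)
open import Data.List.Relation.Unary.Any using (here; there)
open import Data.List.Relation.Unary.All.Properties using (¬Any⇒All¬)
import Data.List.Relation.Unary.AllPairs as AllPairs
import Data.List.Relation.Unary.All as All
open import Data.List.Relation.Unary.Unique.Propositional using (Unique)
open import Data.Maybe using (just)
open import Data.Vec.Functional using () renaming (_∷_ to _∷ᵛ_)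
import Data.Integer as ℤ
import Data.Integer.Properties as ℤ
open import Data.Rational using (ℚ; 1ℚ) renaming (_≤_ to _≤ℚ_)
import Data.Rational.Properties as ℚ
open import Data.Rational.Properties using (toℚᵘ-cancel-≤; toℚᵘ-fromℚᵘ)
open import Data.Rational.Unnormalised using (mkℚᵘ; *≤*)
open import Data.Rational.Unnormalised.Properties using (≤-respˡ-≃; ≤-respʳ-≃; ≃-sym)
open import Data.Product using (Σ; ∃-syntax; _×_; _,_; proj₁; proj₂)
open import Data.Sum using (_⊎_; inj₁; inj₂; [_,_]′)
open import Data.Empty using (⊥; ⊥-elim)
open import Data.Unit using (tt)
open import Function using (_∘_; id)
open import Relation.Nullary using (¬_; Dec; yes; no)
open import Relation.Nullary.Decidable using (toWitness; dec-true; isYes≗does)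
open import Relation.Unary using (Decidable)
open import Relation.Binary.PropositionalEquality

∧-trueˡ : ∀ {a b} → a ∧ b ≡ true → a ≡ true
∧-trueˡ {true} _ = refl

∧-trueʳ : ∀ {a b} → a ∧ b ≡ true → b ≡ true
∧-trueʳ {true} b≡true = b≡true

∧-true : ∀ {a b} → a ≡ true → b ≡ true → a ∧ b ≡ true
∧-true refl refl = refl

∨-true⁻ : ∀ {a b} → a ∨ b ≡ true → a ≡ true ⊎ b ≡ true
∨-true⁻ {true} _ = inj₁ refl
∨-true⁻ {false} b≡true = inj₂ b≡true

∨-trueˡ : ∀ {a} b → a ≡ true → a ∨ b ≡ true
∨-trueˡ _ refl = refl

∨-trueʳ : ∀ a {b} → b ≡ true → a ∨ b ≡ true
∨-trueʳ true _ = refl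
∨-trueʳ false b≡true = b≡true

true≢false : ∀ {a} → a ≡ true → a ≡ false → ⊥
true≢false refl ()

not-∧-true : ∀ a b → (a ≡ true → b ≡ true → ⊥) → not (a ∧ b) ≡ true
not-∧-true true true ¬ab = ⊥-elim (¬ab refl refl)
not-∧-true true false _ = refl
not-∧-true false _ _ = refl

≡true⇒T : ∀ {b} → b ≡ true → T b
≡true⇒T refl = tt

T⇒≡true : ∀ {b} → T b → b ≡ true
T⇒≡true {true} _ = refl

indicator : Bool → ℕ
indicator b = if b then 1 else 0

0<indicator : ∀ {b} → b ≡ true → 0 < indicator b
0<indicator refl = z<s

indicator-mono : ∀ {a b} → (a ≡ true → b ≡ true) → indicator a ≤ indicator b
indicator-mono {false} _ = z≤n
indicator-mono {true} a⇒b rewrite a⇒b refl = ≤-refl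

∑-mono-≤ : ∀ {n} {g h : Fin n → ℕ} → (∀ i → g i ≤ h i) → ∑ g ≤ ∑ h
∑-mono-≤ {zero} _ = z≤n
∑-mono-≤ {suc n} g≤h = +-mono-≤ (g≤h zero) (∑-mono-≤ (g≤h ∘ suc))

≤∑ : ∀ {n} (g : Fin n → ℕ) i → g i ≤ ∑ g
≤∑ g zero = m≤m+n _ _
≤∑ g (suc i) = ≤-trans (≤∑ (g ∘ suc) i) (m≤n+m _ (g zero))

∑-positive : ∀ {n} (g : Fin n → ℕ) → 0 < ∑ g → ∃[ i ] 0 < g i
∑-positive {suc n} g 0<∑ with g zero in eq
... | suc _ = zero , subst (0 <_) (sym eq) z<s
... | zero with ∑-positive (g ∘ suc) 0<∑
...   | i , 0<gi = suc i , 0<gi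

∑-zero : ∀ {n} (g : Fin n → ℕ) → (∀ i → g i ≡ 0) → ∑ g ≡ 0
∑-zero {n} g g≡0 = trans (sum-cong-≗ g≡0) (sum-replicate-zero n)

∑-single : ∀ {n} (g : Fin n → ℕ) v → g v ≡ 1 → (∀ i → i ≢ v → g i ≡ 0) → ∑ g ≡ 1
∑-single {suc n} g v gv≡1 g≡0 = trans (sum-remove {i = v} g)
  (cong₂ _+_ gv≡1 (∑-zero _ (λ j → g≡0 (punchIn v j) (punchInᵢ≢i v j))))

∑-two : ∀ {n} (g : Fin n → ℕ) {a b} → a ≢ b → 0 < g a → 0 < g b → 2 ≤ ∑ g
∑-two {suc n} g {a} {b} a≢b 0<ga 0<gb = subst (2 ≤_) (sym (sum-remove {i = a} g))
  (+-mono-≤ 0<ga (≤-trans (subst (λ v → 0 < g v) (sym (punchIn-punchOut a≢b)) 0<gb) (≤∑ _ (punchOut a≢b))))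

∑-const-1 : ∀ n → ∑ {n} (λ _ → 1) ≡ n
∑-const-1 zero = refl
∑-const-1 (suc n) = cong suc (∑-const-1 n)

∑-inject₁-≤ : ∀ {n} (g : Fin (suc n) → ℕ) → ∑ (g ∘ inject₁) ≤ ∑ g
∑-inject₁-≤ {zero} g = z≤n
∑-inject₁-≤ {suc n} g = +-monoʳ-≤ (g zero) (∑-inject₁-≤ (g ∘ suc))

count≡∑ : ∀ {n} (p : Fin n → Bool) → count p ≡ ∑ (indicator ∘ p)
count≡∑ {n} p = trans (cong sum (map-tabulate id (indicator ∘ p))) (sum-tabulate (indicator ∘ p))
  where
  sum-tabulate : ∀ {m} (g : Fin m → ℕ) → sum (tabulate g) ≡ ∑ g
  sum-tabulate {zero} g = refl
  sum-tabulate {suc m} g = cong (g zero +_) (sum-tabulate (g ∘ suc))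

count-cong : ∀ {n} {p q : Fin n → Bool} → p ≗ q → count p ≡ count q
count-cong {n} p≗q = cong sum (map-cong (cong indicator ∘ p≗q) (allFin n))

count-mono : ∀ {n} (p q : Fin n → Bool) → (∀ i → p i ≡ true → q i ≡ true) → count p ≤ count q
count-mono p q p⇒q = subst₂ _≤_ (sym (count≡∑ p)) (sym (count≡∑ q)) (∑-mono-≤ (indicator-mono ∘ p⇒q))

count-complement : ∀ {n} (p : Fin n → Bool) → count p + count (not ∘ p) ≡ n
count-complement {n} p = begin
  count p + count (not ∘ p)                       ≡⟨ cong₂ _+_ (count≡∑ p) (count≡∑ (not ∘ p)) ⟩
  ∑ (indicator ∘ p) + ∑ (indicator ∘ not ∘ p)     ≡⟨ sym (∑-distrib-+ (indicator ∘ p) (indicator ∘ not ∘ p)) ⟩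
  ∑ (λ i → indicator (p i) + indicator (not (p i))) ≡⟨ sum-cong-≗ (λ i → partition (p i)) ⟩
  ∑ {n} (λ _ → 1)                                 ≡⟨ ∑-const-1 n ⟩
  n                                               ∎
  where
  open ≡-Reasoning
  partition : ∀ b → indicator b + indicator (not b) ≡ 1
  partition true = refl
  partition false = refl

count-witness : ∀ {n} (p : Fin n → Bool) → 0 < count p → ∃[ i ] p i ≡ true
count-witness p 0<count with ∑-positive _ (subst (0 <_) (count≡∑ p) 0<count)
... | i , 0<pi = i , witness 0<pi
  where
  witness : ∀ {b} → 0 < indicator b → b ≡ true
  witness {true} _ = refl

count-positive : ∀ {n} (p : Fin n → Bool) {i} → p i ≡ true → 0 < count p
count-positive p {i} pi≡true = subst (0 <_) (sym (count≡∑ p))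
  (≤-trans (0<indicator pi≡true) (≤∑ _ i))

count-two : ∀ {n} (p : Fin n → Bool) {a b} → a ≢ b → p a ≡ true → p b ≡ true → 2 ≤ count p
count-two p a≢b pa pb = subst (2 ≤_) (sym (count≡∑ p))
  (∑-two _ a≢b (0<indicator pa) (0<indicator pb))

any-tabulate⁺ : ∀ {A : Set} {n} (f : Fin n → A) (p : A → Bool) i → p (f i) ≡ true → any p (tabulate f) ≡ true
any-tabulate⁺ f p zero pfi = ∨-trueˡ _ pfi
any-tabulate⁺ f p (suc i) pfi = ∨-trueʳ (p (f zero)) (any-tabulate⁺ (f ∘ suc) p i pfi)

any-tabulate⁻ : ∀ {A : Set} {n} (f : Fin n → A) (p : A → Bool) → any p (tabulate f) ≡ true → ∃[ i ] p (f i) ≡ true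
any-tabulate⁻ {n = suc n} f p any≡true with ∨-true⁻ {p (f zero)} any≡true
... | inj₁ pf0 = zero , pf0
... | inj₂ rest with any-tabulate⁻ (f ∘ suc) p rest
...   | i , pfi = suc i , pfi

all-tabulate⁺ : ∀ {A : Set} {n} (f : Fin n → A) (p : A → Bool) → (∀ i → p (f i) ≡ true) → all p (tabulate f) ≡ true
all-tabulate⁺ {n = zero} f p _ = refl
all-tabulate⁺ {n = suc n} f p pf = ∧-true (pf zero) (all-tabulate⁺ (f ∘ suc) p (pf ∘ suc))

all-tabulate⁻ : ∀ {A : Set} {n} (f : Fin n → A) (p : A → Bool) → all p (tabulate f) ≡ true → ∀ i → p (f i) ≡ true
all-tabulate⁻ f p all≡true zero = ∧-trueˡ all≡true
all-tabulate⁻ f p all≡true (suc i) = all-tabulate⁻ (f ∘ suc) p (∧-trueʳ {p (f zero)} all≡true) i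

≤-⊔-tabulate : ∀ {A : Set} {n} (g : A → ℕ) (f : Fin n → A) i → g (f i) ≤ foldr _⊔_ 0 (map g (tabulate f))
≤-⊔-tabulate g f zero = m≤m⊔n _ _
≤-⊔-tabulate g f (suc i) = ≤-trans (≤-⊔-tabulate g (f ∘ suc) i) (m≤n⊔m (g (f zero)) _)

⊔-tabulate-lub : ∀ {A : Set} {n} (g : A → ℕ) (f : Fin n → A) {b} → (∀ i → g (f i) ≤ b) → foldr _⊔_ 0 (map g (tabulate f)) ≤ b
⊔-tabulate-lub {n = zero} g f _ = z≤n
⊔-tabulate-lub {n = suc n} g f g≤b = ⊔-lub (g≤b zero) (⊔-tabulate-lub g (f ∘ suc) (g≤b ∘ suc))

-- Vertex sets are functions, so the finite enumeration allVSets only reaches each X up to ≗.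
module _ {n} (G : Graph n) {X Y : VSet n} (X≗Y : X ≗ Y) where

  reachW-resp-≗ : ∀ k u v → reachW G X k u v ≡ reachW G Y k u v
  reachW-resp-≗ zero u v = cong (λ b → not b ∧ _) (X≗Y u)
  reachW-resp-≗ (suc k) u v = cong₂ _∨_ (reachW-resp-≗ k u v)
    (cong or (map-cong (λ w → cong₂ (λ a b → a ∧ adj G w v ∧ not b) (reachW-resp-≗ k u w) (X≗Y v)) (allFin n)))

  conn-resp-≗ : ∀ u v → conn G X u v ≡ conn G Y u v
  conn-resp-≗ = reachW-resp-≗ n

  ω-resp-≗ : ω G X ≡ ω G Y
  ω-resp-≗ = count-cong λ v → cong₂ _∧_ (cong not (X≗Y v))
    (cong and (map-cong (λ u → cong (λ b → not ((toℕ u <ᵇ toℕ v) ∧ b)) (conn-resp-≗ u v)) (allFin n)))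

  τ-resp-≗ : τ G X ≡ τ G Y
  τ-resp-≗ = cong (foldr _⊔_ 0) (map-cong (λ v → count-cong (conn-resp-≗ v)) (allFin n))

  tenRatio-resp-≗ : tenRatio G X ≡ tenRatio G Y
  tenRatio-resp-≗ = cong₂ ratio (cong₂ _+_ (count-cong X≗Y) τ-resp-≗) ω-resp-≗

allVSets : ∀ n → List (VSet n)
allVSets zero = (λ ()) ∷ []
allVSets (suc n) = map (false ∷ᵛ_) (allVSets n) ++ map (true ∷ᵛ_) (allVSets n)

∈-allVSets : ∀ {n} (X : VSet n) → ∃[ Y ] Y ∈ allVSets n × X ≗ Y
∈-allVSets {zero} X = _ , here refl , λ ()
∈-allVSets {suc n} X with ∈-allVSets (X ∘ suc) | X zero in eq
... | Y , Y∈ , X≗Y | false = false ∷ᵛ Y , ∈-++⁺ˡ (∈-map⁺ (false ∷ᵛ_) Y∈) , λ { zero → eq ; (suc i) → X≗Y i }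
... | Y , Y∈ , X≗Y | true = true ∷ᵛ Y , ∈-++⁺ʳ (map (false ∷ᵛ_) (allVSets n)) (∈-map⁺ (true ∷ᵛ_) Y∈) , λ { zero → eq ; (suc i) → X≗Y i }

module _ {A : Set} {P : A → Set} (P? : Decidable P) (f : A → ℚ) where

  argmin : (L : List A) →
    (∃[ a ] a ∈ L × P a × (∀ b → b ∈ L → P b → f a ≤ℚ f b)) ⊎ (∀ b → b ∈ L → ¬ P b)
  argmin [] = inj₂ λ b ()
  argmin (x ∷ L) with argmin L | P? x
  ... | inj₂ none | yes px = inj₁ (x , here refl , px , λ { b (here refl) pb → ℚ.≤-refl ; b (there b∈) pb → ⊥-elim (none b b∈ pb) })
  ... | inj₂ none | no ¬px = inj₂ λ { b (here refl) pb → ¬px pb ; b (there b∈) pb → none b b∈ pb }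
  ... | inj₁ (a , a∈ , pa , min) | no ¬px = inj₁ (a , there a∈ , pa , λ { b (here refl) pb → ⊥-elim (¬px pb) ; b (there b∈) pb → min b b∈ pb })
  ... | inj₁ (a , a∈ , pa , min) | yes px with ℚ.≤-total (f x) (f a)
  ...   | inj₁ x≤a = inj₁ (x , here refl , px , λ { b (here refl) pb → ℚ.≤-refl ; b (there b∈) pb → ℚ.≤-trans x≤a (min b b∈ pb) })
  ...   | inj₂ a≤x = inj₁ (a , there a∈ , pa , λ { b (here refl) pb → a≤x ; b (there b∈) pb → min b b∈ pb })

tenacity-exists : ∀ {n} (G : Graph n) (X₀ : VSet n) → 1 < ω G X₀ →
  Σ ℚ λ t → IsTenacity G t × t ≤ℚ tenRatio G X₀
tenacity-exists {n} G X₀ 1<ω₀ with argmin (λ X → 1 <? ω G X) (tenRatio G) (allVSets n)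
... | inj₁ (X , _ , 1<ω , min) = tenRatio G X , ((X , 1<ω , refl) , below) , below X₀ 1<ω₀
  where
  below : ∀ Z → 1 < ω G Z → tenRatio G X ≤ℚ tenRatio G Z
  below Z 1<ωZ with ∈-allVSets Z
  ... | Z′ , Z′∈ , Z≗Z′ = subst (tenRatio G X ≤ℚ_) (sym (tenRatio-resp-≗ G Z≗Z′))
    (min Z′ Z′∈ (subst (1 <_) (ω-resp-≗ G Z≗Z′) 1<ωZ))
... | inj₂ none with ∈-allVSets X₀
...   | Y₀ , Y₀∈ , X₀≗Y₀ = ⊥-elim (none Y₀ Y₀∈ (subst (1 <_) (ω-resp-≗ G X₀≗Y₀) 1<ω₀))

ratio-≤ : ∀ a {b} c {d} → 0 < b → 0 < d → a * d ≤ c * b → ratio a b ≤ℚ ratio c d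
ratio-≤ a {suc b} c {suc d} _ _ ad≤cb =
  toℚᵘ-cancel-≤ (≤-respˡ-≃ (≃-sym (toℚᵘ-fromℚᵘ (mkℚᵘ (ℤ.+ a) b)))
    (≤-respʳ-≃ (≃-sym (toℚᵘ-fromℚᵘ (mkℚᵘ (ℤ.+ c) d)))
      (*≤* (subst₂ ℤ._≤_ (ℤ.pos-* a (suc d)) (ℤ.pos-* c (suc b)) (ℤ.+≤+ ad≤cb)))))

Edgeless : ∀ {n} → Graph n → VSet n → Set
Edgeless G X = ∀ u v → alive X u ≡ true → alive X v ≡ true → adj G u v ≡ true → ⊥

<ᵇ⇒≢ : ∀ {n} {u v : Fin n} → (toℕ u <ᵇ toℕ v) ≡ true → u ≢ v
<ᵇ⇒≢ {u = u} u<v refl = n≮n (toℕ u) (<ᵇ⇒< (toℕ u) (toℕ u) (≡true⇒T u<v))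

module Reachability {n} (G : Graph n) (X : VSet n) where

  reach-alive : ∀ k u v → reachW G X k u v ≡ true → alive X u ≡ true
  reach-alive zero u v reach = ∧-trueˡ reach
  reach-alive (suc k) u v reach with ∨-true⁻ {reachW G X k u v} reach
  ... | inj₁ shorter = reach-alive k u v shorter
  ... | inj₂ viaW with any-tabulate⁻ id _ viaW
  ...   | w , u⇝w∼v = reach-alive k u w (∧-trueˡ u⇝w∼v)

  reach-refl : ∀ k u → alive X u ≡ true → reachW G X k u u ≡ true
  reach-refl zero u u-alive = ∧-true u-alive (trans (isYes≗does (u ≟ᶠ u)) (dec-true (u ≟ᶠ u) refl))
  reach-refl (suc k) u u-alive = ∨-trueˡ _ (reach-refl k u u-alive)

  reach-step : ∀ k u w v → reachW G X k u w ≡ true → adj G w v ≡ true → alive X v ≡ true →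
    reachW G X (suc k) u v ≡ true
  reach-step k u w v u⇝w w∼v v-alive =
    ∨-trueʳ (reachW G X k u v) (any-tabulate⁺ id _ w (∧-true u⇝w (∧-true w∼v v-alive)))

  reach-weaken : ∀ k d u v → reachW G X k u v ≡ true → reachW G X (d + k) u v ≡ true
  reach-weaken k zero u v reach = reach
  reach-weaken k (suc d) u v reach = ∨-trueˡ _ (reach-weaken k d u v reach)

  reach⇒conn : ∀ k u v → k ≤ n → reachW G X k u v ≡ true → conn G X u v ≡ true
  reach⇒conn k u v k≤n reach =
    subst (λ m → reachW G X m u v ≡ true) (m∸n+n≡m k≤n) (reach-weaken k (n ∸ k) u v reach)

  conn-refl : ∀ u → alive X u ≡ true → conn G X u u ≡ true
  conn-refl = reach-refl n

  componentSize≤τ : ∀ v → count (conn G X v) ≤ τ G X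
  componentSize≤τ = ≤-⊔-tabulate (λ v → count (conn G X v)) id

  τ-positive : 1 < ω G X → 0 < τ G X
  τ-positive 1<ω with count-witness (isRep G X) (<⇒≤ 1<ω)
  ... | v , v-rep = ≤-trans (count-positive (conn G X v) (conn-refl v (∧-trueˡ v-rep))) (componentSize≤τ v)

  ω≤count-alive : ω G X ≤ count (alive X)
  ω≤count-alive = count-mono (isRep G X) (alive X) λ _ → ∧-trueˡ

  τ≤1⇒count-alive≤ω : τ G X ≤ 1 → count (alive X) ≤ ω G X
  τ≤1⇒count-alive≤ω τ≤1 = count-mono (alive X) (isRep G X) λ v v-alive → ∧-true v-alive (all-tabulate⁺ id _ λ u →
    not-∧-true (toℕ u <ᵇ toℕ v) (conn G X u v) λ u<v u⇝v → 1+n≰n (≤-trans (component≥2 u<v u⇝v) τ≤1))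
    where
    component≥2 : ∀ {u v} → (toℕ u <ᵇ toℕ v) ≡ true → conn G X u v ≡ true → 2 ≤ τ G X
    component≥2 {u} {v} u<v u⇝v = ≤-trans
      (count-two (conn G X u) (<ᵇ⇒≢ u<v) (conn-refl u (reach-alive n u v u⇝v)) u⇝v) (componentSize≤τ u)

  module _ (edgeless : Edgeless G X) where

    reach⇒≡ : ∀ k u v → reachW G X k u v ≡ true → u ≡ v
    reach⇒≡ zero u v reach = toWitness (≡true⇒T (∧-trueʳ {alive X u} reach))
    reach⇒≡ (suc k) u v reach with ∨-true⁻ {reachW G X k u v} reach
    ... | inj₁ shorter = reach⇒≡ k u v shorter
    ... | inj₂ viaW with any-tabulate⁻ id _ viaW
    ...   | w , u⇝w∼v with reach⇒≡ k u w (∧-trueˡ u⇝w∼v)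
    ...     | refl = ⊥-elim (edgeless u v (reach-alive k u u (∧-trueˡ u⇝w∼v))
                       (∧-trueʳ {adj G u v} (∧-trueʳ {reachW G X k u u} u⇝w∼v))
                       (∧-trueˡ (∧-trueʳ {reachW G X k u u} u⇝w∼v)))

    componentSize-alive : ∀ v → alive X v ≡ true → count (conn G X v) ≡ 1
    componentSize-alive v v-alive = trans (count≡∑ (conn G X v))
      (∑-single _ v (cong indicator (conn-refl v v-alive)) (λ i i≢v → not-conn i (i≢v ∘ sym)))
      where
      not-conn : ∀ i → v ≢ i → indicator (conn G X v i) ≡ 0
      not-conn i v≢i with conn G X v i in c
      ... | true = ⊥-elim (v≢i (reach⇒≡ n v i c))
      ... | false = refl

    componentSize-dead : ∀ v → alive X v ≡ false → count (conn G X v) ≡ 0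
    componentSize-dead v v-dead = trans (count≡∑ (conn G X v)) (∑-zero _ not-conn)
      where
      not-conn : ∀ i → indicator (conn G X v i) ≡ 0
      not-conn i with conn G X v i in c
      ... | true = ⊥-elim (true≢false (reach-alive n v i c) v-dead)
      ... | false = refl

    τ≡1 : ∀ {v₀} → alive X v₀ ≡ true → τ G X ≡ 1
    τ≡1 {v₀} v₀-alive = ≤-antisym
      (⊔-tabulate-lub (λ v → count (conn G X v)) id (λ v → componentSize≤1 v (alive X v) refl))
      (subst (_≤ τ G X) (componentSize-alive v₀ v₀-alive) (componentSize≤τ v₀))
      where
      componentSize≤1 : ∀ v b → alive X v ≡ b → count (conn G X v) ≤ 1
      componentSize≤1 v true v-alive = ≤-reflexive (componentSize-alive v v-alive)
      componentSize≤1 v false v-dead = ≤-trans (≤-reflexive (componentSize-dead v v-dead)) z≤n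

    isRep≡alive : ∀ v → isRep G X v ≡ alive X v
    isRep≡alive v with X v in eq
    ... | true = refl
    ... | false = all-tabulate⁺ id _ λ u → not-∧-true _ _ λ u<v u⇝v → <ᵇ⇒≢ u<v (reach⇒≡ n u v u⇝v)

    ω≡count-alive : ω G X ≡ count (alive X)
    ω≡count-alive = count-cong isRep≡alive

isEven : ℕ → Bool
isEven zero = true
isEven (suc n) = not (isEven n)

isEven-+ : ∀ a b → isEven (a + b) ≡ (if isEven a then isEven b else not (isEven b))
isEven-+ zero b = refl
isEven-+ (suc a) b rewrite isEven-+ a b with isEven a
... | true = refl
... | false = not-involutive (isEven b)

isEven-double : ∀ m → isEven (m + m) ≡ true
isEven-double zero = refl
isEven-double (suc m) rewrite +-suc m m = trans (not-involutive (isEven (m + m))) (isEven-double m)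

isEven-odd-sum : ∀ a b → isEven (a + b) ≡ false → isEven a ≡ false ⊎ isEven b ≡ false
isEven-odd-sum a b odd rewrite isEven-+ a b with isEven a | isEven b
... | true | true = ⊥-elim (true≢false refl odd)
... | true | false = inj₂ refl
... | false | _ = inj₁ refl

isEven-+-suc : ∀ a b → isEven a ≡ isEven b → isEven (a + suc b) ≡ false
isEven-+-suc a b same rewrite isEven-+ a (suc b) | same with isEven b
... | true = refl
... | false = refl

even⇒double : ∀ n → isEven n ≡ true → ∃[ m ] n ≡ m + m
odd⇒double+1 : ∀ n → isEven n ≡ false → ∃[ m ] n ≡ suc (m + m)
even⇒double zero _ = 0 , refl
even⇒double (suc n) even with odd⇒double+1 n (trans (sym (not-involutive (isEven n))) (cong not even))
... | m , n≡2m+1 = suc m , cong suc (trans n≡2m+1 (sym (+-suc m m)))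
odd⇒double+1 (suc n) odd with even⇒double n (trans (sym (not-involutive (isEven n))) (cong not odd))
... | m , n≡2m = m , cong suc n≡2m

%2≡ᵇ1≡odd : ∀ n → (n % 2 ≡ᵇ 1) ≡ not (isEven n)
%2≡ᵇ1≡odd zero = refl
%2≡ᵇ1≡odd (suc zero) = refl
%2≡ᵇ1≡odd (suc (suc n)) = begin
  (2 + n) % 2 ≡ᵇ 1      ≡⟨ cong (λ m → m % 2 ≡ᵇ 1) (+-comm 2 n) ⟩
  (n + 2) % 2 ≡ᵇ 1      ≡⟨ cong (_≡ᵇ 1) ([m+n]%n≡m%n n 2) ⟩
  n % 2 ≡ᵇ 1            ≡⟨ %2≡ᵇ1≡odd n ⟩
  not (isEven n)        ≡⟨ cong not (sym (not-involutive (isEven n))) ⟩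
  not (isEven (2 + n))  ∎
  where open ≡-Reasoning

maxTreeTenacity-odd : ∀ n → isEven n ≡ false → maxTreeTenacity n ≡ 1ℚ
maxTreeTenacity-odd n odd rewrite %2≡ᵇ1≡odd n | odd = refl

maxTreeTenacity-even : ∀ n → isEven n ≡ true → maxTreeTenacity n ≡ ratio (n + 2) n
maxTreeTenacity-even n even rewrite %2≡ᵇ1≡odd n | even = refl

2≤larger : ∀ a b → 3 ≤ a + b → a ≤ b → 2 ≤ b
2≤larger a b 3≤a+b a≤b = ≰⇒> λ b≤1 → <⇒≱ 3≤a+b (+-mono-≤ (≤-trans a≤b b≤1) b≤1)

ratio≤maxTreeTenacity : ∀ a b → 3 ≤ a + b → a ≤ b → ratio (a + 1) b ≤ℚ maxTreeTenacity (a + b)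
ratio≤maxTreeTenacity a b 3≤a+b a≤b = bound (isEven (a + b)) refl
  where
  0<b : 0 < b
  0<b = ≤-trans z<s (2≤larger a b 3≤a+b a≤b)
  bound : ∀ e → isEven (a + b) ≡ e → ratio (a + 1) b ≤ℚ maxTreeTenacity (a + b)
  bound false odd = subst (ratio (a + 1) b ≤ℚ_) (sym (maxTreeTenacity-odd (a + b) odd))
    (ratio-≤ (a + 1) 1 0<b z<s (subst₂ _≤_ (sym (*-identityʳ (a + 1))) (sym (*-identityˡ b)) a<b))
    where
    a<b : a + 1 ≤ b
    a<b = subst (_≤ b) (+-comm 1 a) (≤∧≢⇒< a≤b λ { refl → true≢false (isEven-double a) odd })
  bound true even = subst (ratio (a + 1) b ≤ℚ_) (sym (maxTreeTenacity-even (a + b) even))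
    (ratio-≤ (a + 1) (a + b + 2) 0<b (≤-trans z<s 3≤a+b) (begin
      (a + 1) * (a + b)     ≡⟨ solve (a ∷ b ∷ []) ⟩
      a * (a + b) + (a + b) ≤⟨ +-mono-≤ (*-monoˡ-≤ (a + b) a≤b) (+-monoˡ-≤ b a≤b) ⟩
      b * (a + b) + (b + b) ≡⟨ solve (a ∷ b ∷ []) ⟩
      (a + b + 2) * b       ∎))
    where open ≤-Reasoning

edgeless-bound : ∀ {n} (G : Graph n) {X : VSet n} → 3 ≤ n → Edgeless G X → count X ≤ count (alive X) →
  1 < ω G X × tenRatio G X ≤ℚ maxTreeTenacity n
edgeless-bound {n} G {X} 3≤n edgeless X≤rest =
  subst (1 <_) (sym ω≡b) 2≤b ,
  subst₂ _≤ℚ_ (sym tenRatio≡) (cong maxTreeTenacity a+b≡n) (ratio≤maxTreeTenacity a b 3≤a+b X≤rest)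
  where
  open Reachability G X
  a = count X
  b = count (alive X)
  a+b≡n : a + b ≡ n
  a+b≡n = count-complement X
  3≤a+b : 3 ≤ a + b
  3≤a+b = subst (3 ≤_) (sym a+b≡n) 3≤n
  2≤b : 2 ≤ b
  2≤b = 2≤larger a b 3≤a+b X≤rest
  ω≡b : ω G X ≡ b
  ω≡b = ω≡count-alive edgeless
  tenRatio≡ : tenRatio G X ≡ ratio (a + 1) b
  tenRatio≡ = cong₂ ratio (cong (a +_) (τ≡1 edgeless (proj₂ (count-witness (alive X) (≤-trans z<s 2≤b))))) ω≡b

ProperColouring : ∀ {n} → Graph n → (Fin n → Bool) → Set
ProperColouring G c = ∀ u v → adj G u v ≡ true → c u ≢ c v

ProperColouring-not : ∀ {n} (G : Graph n) {c} → ProperColouring G c → ProperColouring G (not ∘ c)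
ProperColouring-not G proper u v u∼v = proper u v u∼v ∘ not-injective

ProperColouring⇒Edgeless : ∀ {n} (G : Graph n) {c} → ProperColouring G c → Edgeless G c
ProperColouring⇒Edgeless G proper u v u-alive v-alive u∼v =
  proper u v u∼v (not-injective (trans u-alive (sym v-alive)))

bipartite-bound : ∀ {n} (G : Graph n) {c} → 3 ≤ n → ProperColouring G c →
  ∃[ X ] 1 < ω G X × tenRatio G X ≤ℚ maxTreeTenacity n
bipartite-bound G {c} 3≤n proper with ≤-total (count c) (count (not ∘ c))
... | inj₁ c≤rest = c , edgeless-bound G 3≤n (ProperColouring⇒Edgeless G proper) c≤rest
... | inj₂ rest≤c = not ∘ c , edgeless-bound G 3≤n (ProperColouring⇒Edgeless G (ProperColouring-not G proper))
  (subst (count (not ∘ c) ≤_) (count-cong (sym ∘ not-involutive ∘ c)) rest≤c)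

bipartite⇒tenacity≤max : ∀ {n} (G : Graph n) {c} → 3 ≤ n → ProperColouring G c →
  Σ ℚ λ t → IsTenacity G t × t ≤ℚ maxTreeTenacity n
bipartite⇒tenacity≤max G 3≤n proper with bipartite-bound G 3≤n proper
... | X , 1<ω , ratio≤max with tenacity-exists G X 1<ω
...   | t , tenacity , t≤ratio = t , tenacity , ℚ.≤-trans t≤ratio ratio≤max

module Walks {n} (G : Graph n) where

  open import Data.List.Membership.DecPropositional (_≟ᶠ_ {n}) using (_∈?_)

  infixr 5 _◅_ _◅◅_

  data Walk : Fin n → Fin n → Set where
    ε : ∀ {u} → Walk u u
    _◅_ : ∀ {u w v} → adj G u w ≡ true → Walk w v → Walk u v

  steps : ∀ {u v} → Walk u v → ℕ
  steps ε = 0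
  steps (_ ◅ p) = suc (steps p)

  _◅◅_ : ∀ {u w v} → Walk u w → Walk w v → Walk u v
  ε ◅◅ q = q
  (e ◅ p) ◅◅ q = e ◅ (p ◅◅ q)

  steps-◅◅ : ∀ {u w v} (p : Walk u w) (q : Walk w v) → steps (p ◅◅ q) ≡ steps p + steps q
  steps-◅◅ ε q = refl
  steps-◅◅ (e ◅ p) q = cong suc (steps-◅◅ p q)

  reverse : ∀ {u v} → Walk u v → Walk v u
  reverse ε = ε
  reverse (_◅_ {u} {w} e p) = reverse p ◅◅ (trans (adj-sym G w u) e ◅ ε)

  steps-reverse : ∀ {u v} (p : Walk u v) → steps (reverse p) ≡ steps p
  steps-reverse ε = refl
  steps-reverse (e ◅ p) = trans (steps-◅◅ (reverse p) _) (trans (+-comm (steps (reverse p)) 1) (cong suc (steps-reverse p)))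

  reach⇒walk : ∀ k u v → reachW G emptySet k u v ≡ true → Walk u v
  reach⇒walk zero u v reach with toWitness (≡true⇒T (∧-trueʳ {alive emptySet u} reach))
  ... | refl = ε
  reach⇒walk (suc k) u v reach with ∨-true⁻ {reachW G emptySet k u v} reach
  ... | inj₁ shorter = reach⇒walk k u v shorter
  ... | inj₂ viaW with any-tabulate⁻ id _ viaW
  ...   | w , u⇝w∼v = reach⇒walk k u w (∧-trueˡ u⇝w∼v) ◅◅ (∧-trueˡ (∧-trueʳ {reachW G emptySet k u w} u⇝w∼v) ◅ ε)

  vertices : ∀ {u v} → Walk u v → List (Fin n)
  vertices ε = []
  vertices (_◅_ {u} _ p) = u ∷ vertices p

  length-vertices : ∀ {u v} (p : Walk u v) → length (vertices p) ≡ steps p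
  length-vertices ε = refl
  length-vertices (e ◅ p) = cong suc (length-vertices p)

  Walk⇒IsWalk : ∀ {u v} (p : Walk u v) → IsWalk G (vertices p ++ v ∷ [])
  Walk⇒IsWalk ε = tt
  Walk⇒IsWalk (e ◅ ε) = e , tt
  Walk⇒IsWalk (e ◅ e′ ◅ p) = e , Walk⇒IsWalk (e′ ◅ p)

  -- z ∷ zs stands for the closed walk z, zs …, z; the return to z is not listed.
  ClosedWalk : List (Fin n) → Set
  ClosedWalk [] = ⊥
  ClosedWalk (z ∷ zs) = IsWalk G (z ∷ zs ++ z ∷ [])

  Walk⇒ClosedWalk : ∀ {x} (p : Walk x x) → 0 < steps p → ClosedWalk (vertices p)
  Walk⇒ClosedWalk (e ◅ p) _ = Walk⇒IsWalk (e ◅ p)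

  IsWalk-∷⁻ : ∀ x xs → IsWalk G (x ∷ xs) → IsWalk G xs
  IsWalk-∷⁻ x [] _ = tt
  IsWalk-∷⁻ x (y ∷ xs) (_ , walk) = walk

  IsWalk-++⁻ʳ : ∀ xs ys → IsWalk G (xs ++ ys) → IsWalk G ys
  IsWalk-++⁻ʳ [] ys walk = walk
  IsWalk-++⁻ʳ (x ∷ xs) ys walk = IsWalk-++⁻ʳ xs ys (IsWalk-∷⁻ x (xs ++ ys) walk)

  IsWalk-++⁻ˡ : ∀ xs ys → IsWalk G (xs ++ ys) → IsWalk G xs
  IsWalk-++⁻ˡ [] ys _ = tt
  IsWalk-++⁻ˡ (x ∷ []) ys _ = tt
  IsWalk-++⁻ˡ (x ∷ x′ ∷ xs) ys (e , walk) = e , IsWalk-++⁻ˡ (x′ ∷ xs) ys walk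

  IsWalk-upTo : ∀ xs y ys → IsWalk G (xs ++ y ∷ ys) → IsWalk G (xs ++ y ∷ [])
  IsWalk-upTo xs y ys walk = IsWalk-++⁻ˡ (xs ++ y ∷ []) ys (subst (IsWalk G) (sym (++-assoc xs (y ∷ []) ys)) walk)

  IsWalk-join : ∀ xs y zs → IsWalk G (xs ++ y ∷ []) → IsWalk G (y ∷ zs) → IsWalk G (xs ++ y ∷ zs)
  IsWalk-join [] y zs _ walk = walk
  IsWalk-join (x ∷ []) y zs (e , _) walk = e , walk
  IsWalk-join (x ∷ x′ ∷ xs) y zs (e , walk₁) walk₂ = e , IsWalk-join (x′ ∷ xs) y zs walk₁ walk₂

  ClosedWalk-rotate : ∀ as y rest → ClosedWalk (as ++ y ∷ rest) → ClosedWalk (y ∷ rest ++ as)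
  ClosedWalk-rotate [] y rest closed = subst (λ l → IsWalk G (y ∷ l ++ y ∷ [])) (sym (++-identityʳ rest)) closed
  ClosedWalk-rotate (a ∷ as) y rest closed =
    subst (λ l → IsWalk G (y ∷ l)) (sym (++-assoc rest (a ∷ as) (y ∷ [])))
      (IsWalk-join (y ∷ rest) a (as ++ y ∷ []) (IsWalk-++⁻ʳ (a ∷ as) _ unrolled) (IsWalk-upTo (a ∷ as) y _ unrolled))
    where
    unrolled : IsWalk G ((a ∷ as) ++ y ∷ (rest ++ a ∷ []))
    unrolled = subst (λ l → IsWalk G (a ∷ l)) (++-assoc as (y ∷ rest) (a ∷ [])) closed

  ClosedWalk-split : ∀ as y bs cs → ClosedWalk (as ++ y ∷ bs ++ y ∷ cs) → ClosedWalk (y ∷ bs) × ClosedWalk (y ∷ cs ++ as)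
  ClosedWalk-split as y bs cs closed =
    IsWalk-upTo (y ∷ bs) y ((cs ++ as) ++ y ∷ []) unrolled , IsWalk-++⁻ʳ (y ∷ bs) (y ∷ (cs ++ as) ++ y ∷ []) unrolled
    where
    rotated : ClosedWalk (y ∷ bs ++ y ∷ cs ++ as)
    rotated = subst (λ l → ClosedWalk (y ∷ l)) (++-assoc bs (y ∷ cs) as) (ClosedWalk-rotate as y (bs ++ y ∷ cs) closed)
    unrolled : IsWalk G (y ∷ bs ++ y ∷ (cs ++ as) ++ y ∷ [])
    unrolled = subst (λ l → IsWalk G (y ∷ l)) (++-assoc bs (y ∷ cs ++ as) (y ∷ [])) rotated

  unique-or-repeat : ∀ zs → Unique zs ⊎ ∃[ as ] ∃[ bs ] ∃[ cs ] ∃[ y ] zs ≡ as ++ y ∷ bs ++ y ∷ cs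
  unique-or-repeat [] = inj₁ AllPairs.[]
  unique-or-repeat (z ∷ zs) with z ∈? zs
  ... | yes z∈zs with ∈-∃++ z∈zs
  ...   | bs , cs , refl = inj₂ ([] , bs , cs , z , refl)
  unique-or-repeat (z ∷ zs) | no z∉zs with unique-or-repeat zs
  ... | inj₁ unique = inj₁ (¬Any⇒All¬ zs z∉zs AllPairs.∷ unique)
  ... | inj₂ (as , bs , cs , y , refl) = inj₂ (z ∷ as , bs , cs , y , refl)

  length-repeat : ∀ (as : List (Fin n)) y bs cs → length (as ++ y ∷ bs ++ y ∷ cs) ≡ length (y ∷ bs) + length (y ∷ cs ++ as)
  length-repeat as y bs cs = begin
    length (as ++ y ∷ bs ++ y ∷ cs)                 ≡⟨ length-++ as ⟩
    length as + suc (length (bs ++ y ∷ cs))         ≡⟨ cong (λ m → length as + suc m) (length-++ bs) ⟩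
    length as + suc (length bs + suc (length cs))   ≡⟨ rearrange (length as) (length bs) (length cs) ⟩
    suc (length bs) + suc (length cs + length as)   ≡⟨ cong (λ m → suc (length bs) + suc m) (sym (length-++ cs)) ⟩
    length (y ∷ bs) + length (y ∷ cs ++ as)         ∎
    where
    open ≡-Reasoning
    rearrange : ∀ a b c → a + suc (b + suc c) ≡ suc b + suc (c + a)
    rearrange = solve-∀

  lastOf : Fin n → List (Fin n) → Fin n
  lastOf a [] = a
  lastOf a (b ∷ l) = lastOf b l

  last-∷ : ∀ a l → last (a ∷ l) ≡ just (lastOf a l)
  last-∷ a [] = refl
  last-∷ a (b ∷ l) = last-∷ b l

  lastOf-adj : ∀ a xs b → IsWalk G (a ∷ xs ++ b ∷ []) → adj G (lastOf a xs) b ≡ true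
  lastOf-adj a [] b (e , _) = e
  lastOf-adj a (x ∷ xs) b (_ , walk) = lastOf-adj x xs b walk

  ClosedWalk⇒Closes : ∀ z zs → ClosedWalk (z ∷ zs) → Closes G (z ∷ zs)
  ClosedWalk⇒Closes z zs closed with last (z ∷ zs) | last-∷ z zs
  ... | just _ | refl = lastOf-adj z zs z closed

  Closes⇒adj : ∀ x xs → Closes G (x ∷ xs) → adj G (lastOf x xs) x ≡ true
  Closes⇒adj x xs closes with last (x ∷ xs) | last-∷ x xs
  ... | just _ | refl = closes

  oddClosedWalk-length≥3 : ∀ z zs → isEven (length (z ∷ zs)) ≡ false → ClosedWalk (z ∷ zs) → 3 ≤ length (z ∷ zs)
  oddClosedWalk-length≥3 z [] _ (z∼z , _) = ⊥-elim (true≢false z∼z (irrefl G z))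
  oddClosedWalk-length≥3 z (_ ∷ []) () _
  oddClosedWalk-length≥3 z (_ ∷ _ ∷ _) _ _ = s≤s (s≤s (s≤s z≤n))

  -- At a repeated vertex the closed walk splits into two shorter closed walks whose lengths add up,
  -- so one of them is odd; fuel bounds the length to make the recursion structural.
  oddClosedWalk⇒cycle : ∀ fuel zs → length zs ≤ fuel → isEven (length zs) ≡ false → ClosedWalk zs → ∃[ vs ] IsCycle G vs
  oddClosedWalk⇒cycle fuel (z ∷ zs) ≤fuel odd closed with unique-or-repeat (z ∷ zs)
  ... | inj₁ unique = z ∷ zs , oddClosedWalk-length≥3 z zs odd closed , unique ,
    IsWalk-++⁻ˡ (z ∷ zs) (z ∷ []) closed , ClosedWalk⇒Closes z zs closed
  ... | inj₂ (as , bs , cs , y , z∷zs≡) =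
    recurse fuel (subst (_≤ fuel) total ≤fuel) (subst (λ m → isEven m ≡ false) total odd)
    where
    total : length (z ∷ zs) ≡ length (y ∷ bs) + length (y ∷ cs ++ as)
    total = trans (cong length z∷zs≡) (length-repeat as y bs cs)
    halves : ClosedWalk (y ∷ bs) × ClosedWalk (y ∷ cs ++ as)
    halves = ClosedWalk-split as y bs cs (subst ClosedWalk z∷zs≡ closed)
    ℓ₁ ℓ₂ : ℕ
    ℓ₁ = length bs
    ℓ₂ = length (cs ++ as)
    recurse : ∀ fuel → suc ℓ₁ + suc ℓ₂ ≤ fuel → isEven (suc ℓ₁ + suc ℓ₂) ≡ false → ∃[ vs ] IsCycle G vs
    recurse (suc f) ≤fuel odd = [ shorterˡ , shorterʳ ]′ (isEven-odd-sum (suc ℓ₁) (suc ℓ₂) odd)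
      where
      shorterˡ : isEven (suc ℓ₁) ≡ false → ∃[ vs ] IsCycle G vs
      shorterˡ odd₁ = oddClosedWalk⇒cycle f (y ∷ bs)
        (≤-trans (s≤s (m≤m+n ℓ₁ ℓ₂)) (≤-trans (≤-reflexive (sym (+-suc ℓ₁ ℓ₂))) (s≤s⁻¹ ≤fuel))) odd₁ (proj₁ halves)
      shorterʳ : isEven (suc ℓ₂) ≡ false → ∃[ vs ] IsCycle G vs
      shorterʳ odd₂ = oddClosedWalk⇒cycle f (y ∷ cs ++ as) (≤-trans (m≤n+m (suc ℓ₂) ℓ₁) (s≤s⁻¹ ≤fuel)) odd₂ (proj₂ halves)

tree⇒bipartite : ∀ {n} (G : Graph n) → IsTree G → ∃[ c ] ProperColouring G c
tree⇒bipartite {zero} G _ = (λ ()) , λ ()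
tree⇒bipartite {suc m} G (connected , acyclic) = colour , proper
  where
  open Walks G
  fromRoot : ∀ v → Walk zero v
  fromRoot v = reach⇒walk (suc m) zero v (connected zero v)
  colour : Fin (suc m) → Bool
  colour v = isEven (steps (fromRoot v))
  proper : ProperColouring G colour
  proper u v u∼v same = acyclic _ (proj₂ (oddClosedWalk⇒cycle _ (vertices loop) ≤-refl odd (Walk⇒ClosedWalk loop 0<steps)))
    where
    loop : Walk zero zero
    loop = fromRoot u ◅◅ u∼v ◅ reverse (fromRoot v)
    steps-loop : steps loop ≡ steps (fromRoot u) + suc (steps (fromRoot v))
    steps-loop = trans (steps-◅◅ (fromRoot u) _) (cong (λ k → steps (fromRoot u) + suc k) (steps-reverse (fromRoot v)))
    odd : isEven (length (vertices loop)) ≡ false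
    odd = trans (cong isEven (trans (length-vertices loop) steps-loop)) (isEven-+-suc (steps (fromRoot u)) (steps (fromRoot v)) same)
    0<steps : 0 < steps loop
    0<steps = subst (0 <_) (sym steps-loop) (≤-trans z<s (m≤n+m _ (steps (fromRoot u))))

≡ᵇ-suc : ∀ m → (m ≡ᵇ suc m) ≡ false
≡ᵇ-suc zero = refl
≡ᵇ-suc (suc m) = ≡ᵇ-suc m

path : ∀ n → Graph n
path n = record
  { adj = λ i j → (toℕ j ≡ᵇ suc (toℕ i)) ∨ (toℕ i ≡ᵇ suc (toℕ j))
  ; sym = λ i j → ∨-comm (toℕ j ≡ᵇ suc (toℕ i)) (toℕ i ≡ᵇ suc (toℕ j))
  ; irrefl = λ i → cong₂ _∨_ (≡ᵇ-suc (toℕ i)) (≡ᵇ-suc (toℕ i))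
  }

module _ {n} {i j : Fin n} where

  path-adj⁻ : adj (path n) i j ≡ true → toℕ j ≡ suc (toℕ i) ⊎ toℕ i ≡ suc (toℕ j)
  path-adj⁻ i∼j with ∨-true⁻ {toℕ j ≡ᵇ suc (toℕ i)} i∼j
  ... | inj₁ up = inj₁ (≡ᵇ⇒≡ _ _ (≡true⇒T up))
  ... | inj₂ down = inj₂ (≡ᵇ⇒≡ _ _ (≡true⇒T down))

  path-adj-up : toℕ j ≡ suc (toℕ i) → adj (path n) i j ≡ true
  path-adj-up j≡1+i = ∨-trueˡ _ (T⇒≡true (≡⇒≡ᵇ _ _ j≡1+i))

  path-adj-down : toℕ i ≡ suc (toℕ j) → adj (path n) i j ≡ true
  path-adj-down i≡1+j = ∨-trueʳ (toℕ j ≡ᵇ suc (toℕ i)) (T⇒≡true (≡⇒≡ᵇ _ _ i≡1+j))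

  path-adj⇒≤suc : adj (path n) i j ≡ true → toℕ i ≤ suc (toℕ j)
  path-adj⇒≤suc i∼j with path-adj⁻ i∼j
  ... | inj₁ j≡1+i = subst (toℕ i ≤_) (cong suc (sym j≡1+i)) (≤-trans (n≤1+n (toℕ i)) (n≤1+n (suc (toℕ i))))
  ... | inj₂ i≡1+j = ≤-reflexive i≡1+j

path-properColouring : ∀ n → ProperColouring (path n) (isEven ∘ toℕ)
path-properColouring n u v u∼v same with path-adj⁻ {i = u} {v} u∼v
... | inj₁ v≡1+u = not-¬ refl (trans same (cong isEven v≡1+u))
... | inj₂ u≡1+v = not-¬ refl (trans (sym same) (cong isEven u≡1+v))

module _ (n : ℕ) where

  open Reachability (path n) emptySet
  open Walks (path n) using (lastOf; Closes⇒adj)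

  reach-up : ∀ k (u v : Fin n) → toℕ v ≡ toℕ u + k → reachW (path n) emptySet k u v ≡ true
  reach-up zero u v v≡u+0 = subst (λ w → reachW (path n) emptySet 0 u w ≡ true)
    (toℕ-injective (trans (sym (+-identityʳ (toℕ u))) (sym v≡u+0))) (reach-refl 0 u refl)
  reach-up (suc k) u v v≡u+1+k = reach-step k u w v (reach-up k u w (toℕ-fromℕ< w<n)) (path-adj-up {i = w} {v} v≡1+w) refl
    where
    v≡1+u+k : toℕ v ≡ suc (toℕ u + k)
    v≡1+u+k = trans v≡u+1+k (+-suc (toℕ u) k)
    w<n : toℕ u + k < n
    w<n = ≤-trans (≤-reflexive (sym v≡1+u+k)) (<⇒≤ (toℕ<n v))
    w = fromℕ< w<n
    v≡1+w : toℕ v ≡ suc (toℕ w)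
    v≡1+w = trans v≡1+u+k (cong suc (sym (toℕ-fromℕ< w<n)))

  reach-down : ∀ k (u v : Fin n) → toℕ u ≡ toℕ v + k → reachW (path n) emptySet k u v ≡ true
  reach-down zero u v u≡v+0 = subst (λ w → reachW (path n) emptySet 0 u w ≡ true)
    (toℕ-injective (trans u≡v+0 (+-identityʳ (toℕ v)))) (reach-refl 0 u refl)
  reach-down (suc k) u v u≡v+1+k = reach-step k u w v (reach-down k u w u≡w+k) (path-adj-down {i = w} {v} w≡1+v) refl
    where
    w<n : suc (toℕ v) < n
    w<n = ≤-trans (s≤s (≤-trans (s≤s (m≤m+n (toℕ v) k)) (≤-reflexive (sym (trans u≡v+1+k (+-suc (toℕ v) k)))))) (toℕ<n u)
    w = fromℕ< w<n
    w≡1+v : toℕ w ≡ suc (toℕ v)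
    w≡1+v = toℕ-fromℕ< w<n
    u≡w+k : toℕ u ≡ toℕ w + k
    u≡w+k = trans u≡v+1+k (trans (+-suc (toℕ v) k) (cong (_+ k) (sym w≡1+v)))

  path-connected : Connected (path n)
  path-connected u v with ≤-total (toℕ u) (toℕ v)
  ... | inj₁ u≤v = reach⇒conn (toℕ v ∸ toℕ u) u v (≤-trans (m∸n≤m (toℕ v) (toℕ u)) (<⇒≤ (toℕ<n v)))
    (reach-up (toℕ v ∸ toℕ u) u v (sym (m+[n∸m]≡n u≤v)))
  ... | inj₂ v≤u = reach⇒conn (toℕ u ∸ toℕ v) u v (≤-trans (m∸n≤m (toℕ u) (toℕ v)) (<⇒≤ (toℕ<n u)))
    (reach-down (toℕ u ∸ toℕ v) u v (sym (m+[n∸m]≡n v≤u)))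

  first≢third : ∀ {a b c : Fin n} {r} → Unique (a ∷ b ∷ c ∷ r) → a ≢ c
  first≢third unique = All.head (All.tail (AllPairs.head unique))

  -- A walk on distinct vertices of the path keeps moving in its initial direction, so it cannot close up.
  ascending : ∀ a b rest → IsWalk (path n) (a ∷ b ∷ rest) → Unique (a ∷ b ∷ rest) →
    toℕ b ≡ suc (toℕ a) → toℕ (lastOf b rest) ≡ toℕ b + length rest
  ascending a b [] _ _ _ = sym (+-identityʳ (toℕ b))
  ascending a b (c ∷ r) (_ , b∼c , walk) unique b≡1+a with path-adj⁻ b∼c
  ... | inj₁ c≡1+b = trans (ascending b c r (b∼c , walk) (AllPairs.tail unique) c≡1+b)
    (trans (cong (_+ length r) c≡1+b) (sym (+-suc (toℕ b) (length r))))
  ... | inj₂ b≡1+c = ⊥-elim (first≢third unique (toℕ-injective (suc-injective (trans (sym b≡1+a) b≡1+c))))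

  descending : ∀ a b rest → IsWalk (path n) (a ∷ b ∷ rest) → Unique (a ∷ b ∷ rest) →
    toℕ a ≡ suc (toℕ b) → toℕ b ≡ toℕ (lastOf b rest) + length rest
  descending a b [] _ _ _ = sym (+-identityʳ (toℕ b))
  descending a b (c ∷ r) (_ , b∼c , walk) unique a≡1+b with path-adj⁻ b∼c
  ... | inj₂ b≡1+c = trans b≡1+c (trans (cong suc (descending b c r (b∼c , walk) (AllPairs.tail unique) b≡1+c))
    (sym (+-suc (toℕ (lastOf c r)) (length r))))
  ... | inj₁ c≡1+b = ⊥-elim (first≢third unique (toℕ-injective (trans a≡1+b (sym c≡1+b))))

  path-acyclic : Acyclic (path n)
  path-acyclic (_ ∷ []) (s≤s () , _)
  path-acyclic (_ ∷ _ ∷ []) (s≤s (s≤s ()) , _)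
  path-acyclic (a ∷ b ∷ c ∷ r) (_ , unique , walk , closes) with path-adj⁻ (proj₁ walk)
  ... | inj₁ b≡1+a = m+1+n≰m (suc (toℕ a)) (begin
    suc (toℕ a) + suc (length r)      ≡⟨ cong (_+ suc (length r)) (sym b≡1+a) ⟩
    toℕ b + length (c ∷ r)            ≡⟨ sym (ascending a b (c ∷ r) walk unique b≡1+a) ⟩
    toℕ (lastOf b (c ∷ r))            ≤⟨ path-adj⇒≤suc (Closes⇒adj a (b ∷ c ∷ r) closes) ⟩
    suc (toℕ a)                       ∎)
    where open ≤-Reasoning
  ... | inj₂ a≡1+b = m+1+n≰m (toℕ ℓ) (s≤s⁻¹ (begin
    suc (toℕ ℓ + suc (length r))      ≡⟨ cong suc (sym (descending a b (c ∷ r) walk unique a≡1+b)) ⟩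
    suc (toℕ b)                       ≡⟨ sym a≡1+b ⟩
    toℕ a                             ≤⟨ path-adj⇒≤suc (trans (adj-sym (path n) a ℓ) (Closes⇒adj a (b ∷ c ∷ r) closes)) ⟩
    suc (toℕ ℓ)                       ∎))
    where
    open ≤-Reasoning
    ℓ = lastOf b (c ∷ r)

  path-isTree : IsTree (path n)
  path-isTree = path-connected , path-acyclic

double≤odd⇒≤ : ∀ w k → w + w ≤ suc (k + k) → w ≤ k
double≤odd⇒≤ zero k _ = z≤n
double≤odd⇒≤ (suc w) zero w+w≤1 rewrite +-suc w w with w+w≤1
... | s≤s ()
double≤odd⇒≤ (suc w) (suc k) 2+2w≤3+2k rewrite +-suc w w | +-suc k k =
  s≤s (double≤odd⇒≤ w k (s≤s⁻¹ (s≤s⁻¹ 2+2w≤3+2k)))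

-- Here x = |X|, a = n − |X|, w = ω(Pₙ − X) and t = τ(Pₙ − X) for n = k + k.
evenPath-arith : ∀ k {x a w t} → x + a ≡ k + k → w ≤ x + 1 → w ≤ a → 1 ≤ t → (t ≤ 1 → a ≤ w) →
  (k + k + 2) * w ≤ (x + t) * (k + k)
evenPath-arith k {x} {a} {w} {t} x+a≡2k w≤x+1 w≤a 1≤t t≤1⇒a≤w = bound (t ≤? 1)
  where
  open ≤-Reasoning
  w≤k : w ≤ k
  w≤k = double≤odd⇒≤ w k (begin
    w + w         ≤⟨ +-mono-≤ w≤x+1 w≤a ⟩
    x + 1 + a     ≡⟨ solve (x ∷ a ∷ []) ⟩
    suc (x + a)   ≡⟨ cong suc x+a≡2k ⟩
    suc (k + k)   ∎)
  bound : Dec (t ≤ 1) → (k + k + 2) * w ≤ (x + t) * (k + k)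
  bound (yes t≤1) = begin
    (k + k + 2) * w        ≡⟨ solve (k ∷ w ∷ []) ⟩
    (k + k) * w + (w + w)  ≤⟨ +-mono-≤ (*-monoʳ-≤ (k + k) w≤x) (+-mono-≤ w≤k w≤k) ⟩
    (k + k) * x + (k + k)  ≡⟨ solve (k ∷ x ∷ []) ⟩
    (x + 1) * (k + k)      ≡⟨ cong (λ s → (x + s) * (k + k)) (sym (≤-antisym t≤1 1≤t)) ⟩
    (x + t) * (k + k)      ∎
    where
    a≤k : a ≤ k
    a≤k = ≤-trans (t≤1⇒a≤w t≤1) w≤k
    w≤x : w ≤ x
    w≤x = ≤-trans w≤k (+-cancelʳ-≤ k k x (≤-trans (≤-reflexive (sym x+a≡2k)) (+-monoʳ-≤ x a≤k)))
  bound (no t≰1) = begin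
    (k + k + 2) * w              ≡⟨ solve (k ∷ w ∷ []) ⟩
    (k + k) * w + (w + w)        ≤⟨ +-mono-≤ (*-monoʳ-≤ (k + k) w≤x+1) (+-mono-≤ w≤k w≤k) ⟩
    (k + k) * (x + 1) + (k + k)  ≡⟨ solve (k ∷ x ∷ []) ⟩
    (x + 2) * (k + k)            ≤⟨ *-monoˡ-≤ (k + k) (+-monoʳ-≤ x (≰⇒> t≰1)) ⟩
    (x + t) * (k + k)            ∎

module _ (m : ℕ) (X : VSet (suc m)) where

  open Reachability (path (suc m)) X

  isRep-suc⇒deleted : ∀ (j : Fin m) → isRep (path (suc m)) X (suc j) ≡ true → X (inject₁ j) ≡ true
  isRep-suc⇒deleted j rep with X (inject₁ j) in eq
  ... | true = refl
  ... | false = ⊥-elim (true≢false (all-tabulate⁻ id _ (∧-trueʳ {alive X (suc j)} rep) (inject₁ j))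
                                  (cong₂ (λ a b → not (a ∧ b)) j<1+j j⇝1+j))
    where
    j<1+j : (toℕ (inject₁ j) <ᵇ toℕ (suc j)) ≡ true
    j<1+j = T⇒≡true (<⇒<ᵇ (s≤s (≤-reflexive (toℕ-inject₁ j))))
    j⇝1+j : conn (path (suc m)) X (inject₁ j) (suc j) ≡ true
    j⇝1+j = reach⇒conn 1 _ _ (s≤s z≤n) (reach-step 0 _ _ _ (reach-refl 0 _ (cong not eq))
      (path-adj-up {i = inject₁ j} {suc j} (cong suc (sym (toℕ-inject₁ j)))) (∧-trueˡ rep))

  path-ω≤ : ω (path (suc m)) X ≤ count X + 1
  path-ω≤ = begin
    ω P X                                                                ≡⟨ count≡∑ (isRep P X) ⟩
    indicator (isRep P X zero) + ∑ (λ j → indicator (isRep P X (suc j))) ≤⟨ +-mono-≤ (indicator≤1 _) (∑-mono-≤ (indicator-mono ∘ isRep-suc⇒deleted)) ⟩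
    1 + ∑ (λ j → indicator (X (inject₁ j)))                              ≤⟨ +-monoʳ-≤ 1 (∑-inject₁-≤ (indicator ∘ X)) ⟩
    1 + ∑ (indicator ∘ X)                                                ≡⟨ cong suc (sym (count≡∑ X)) ⟩
    1 + count X                                                          ≡⟨ +-comm 1 (count X) ⟩
    count X + 1                                                          ∎
    where
    open ≤-Reasoning
    P = path (suc m)
    indicator≤1 : ∀ b → indicator b ≤ 1
    indicator≤1 true = ≤-refl
    indicator≤1 false = z≤n

  path-tenRatio≥ : 1 < ω (path (suc m)) X → maxTreeTenacity (suc m) ≤ℚ tenRatio (path (suc m)) X
  path-tenRatio≥ 1<ω = bound (isEven (suc m)) refl
    where
    x = count X
    w = ω (path (suc m)) X
    t = τ (path (suc m)) X
    0<w : 0 < w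
    0<w = <⇒≤ 1<ω
    bound : ∀ e → isEven (suc m) ≡ e → maxTreeTenacity (suc m) ≤ℚ tenRatio (path (suc m)) X
    bound false odd = subst (_≤ℚ tenRatio (path (suc m)) X) (sym (maxTreeTenacity-odd (suc m) odd))
      (ratio-≤ 1 (x + t) z<s 0<w (subst₂ _≤_ (sym (*-identityˡ w)) (sym (*-identityʳ (x + t)))
        (≤-trans path-ω≤ (+-monoʳ-≤ x (τ-positive 1<ω)))))
    bound true even with even⇒double (suc m) even
    ... | k , n≡2k = subst (_≤ℚ tenRatio (path (suc m)) X) (sym (maxTreeTenacity-even (suc m) even))
      (ratio-≤ (suc m + 2) (x + t) z<s 0<w (subst (λ N → (N + 2) * w ≤ (x + t) * N) (sym n≡2k)
        (evenPath-arith k (trans (count-complement X) n≡2k) path-ω≤ ω≤count-alive (τ-positive 1<ω) τ≤1⇒count-alive≤ω)))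

corollary2 : (n : ℕ) → 3 ≤ n →
    ((G : Graph n) → IsTree G → Σ ℚ λ t → IsTenacity G t × t ≤ℚ maxTreeTenacity n) ×
    (Σ (Graph n) λ G → IsTree G × IsTenacity G (maxTreeTenacity n))
corollary2 (suc m) 3≤n = treeBound , path (suc m) , path-isTree (suc m) , pathTenacity
  where
  treeBound : (G : Graph (suc m)) → IsTree G → Σ ℚ λ t → IsTenacity G t × t ≤ℚ maxTreeTenacity (suc m)
  treeBound G tree = bipartite⇒tenacity≤max G 3≤n (proj₂ (tree⇒bipartite G tree))
  pathTenacity : IsTenacity (path (suc m)) (maxTreeTenacity (suc m))
  pathTenacity with bipartite⇒tenacity≤max (path (suc m)) 3≤n (path-properColouring (suc m))
  ... | t , tenacity@((X , 1<ω , ratio≡t) , _) , t≤max =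
    subst (IsTenacity (path (suc m))) (ℚ.≤-antisym t≤max (subst (_ ≤ℚ_) ratio≡t (path-tenRatio≥ m X 1<ω))) tenacity
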